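{- Let $\mathcal{A}$ be an extensional $\mathbf{BI}(\_)^\bullet$-algebra. Then the internal operad $\mathcal{I}_{\mathcal{A}}$ is a closed operad (with identity $\mathbf{I}$ and $\mathbf{app}=\mathbf{B}$), $\mathcal{I}_{\mathcal{A}}(0)=\{a^\bullet\mid a\in\mathcal{A}\}$, and $a\mapsto a^\bullet$ is a bijection $\mathcal{A}\to\mathcal{I}_{\mathcal{A}}(0)$ satisfying $(a\,b)^\bullet=\mathbf{app}(a^\bullet,b^\bullet)$ (composition in $\mathcal{I}_{\mathcal{A}}$); that is, $\mathcal{A}$ is combinatory complete and extensional with respect to $\mathcal{I}_{\mathcal{A}}$.
   Context: An extensional $\mathbf{BI}(\_)^\bullet$-algebra is a set $\mathcal{A}$ with a binary application written by juxtaposition (left associative), elements $\mathbf{B},\mathbf{I}$ and a function $a\mapsto a^\bullet$ such that for all $a,b,c$: $\mathbf{I}\,a=a$; $\mathbf{B}\,a\,b\,c=a\,(b\,c)$; $a^\bullet\,b=b\,a$; $\mathbf{B}\,\mathbf{I}=\mathbf{I}$; $(a\,b)^\bullet=\mathbf{B}\,b^\bullet\,(\mathbf{B}\,a^\bullet\,\mathbf{B})$; $\mathbf{B}\,\mathbf{B}^\bullet\,(\mathbf{B}\,\mathbf{B}\,(\mathbf{B}\,\mathbf{B}\,\mathbf{B}))=\mathbf{B}\,(\mathbf{B}\,\mathbf{B})\,\mathbf{B}$; $\mathbf{B}\,\mathbf{I}^\bullet\,\mathbf{B}=\mathbf{I}$; $\mathbf{B}\,a^{\bullet\bullet}\,\mathbf{B}=\mathbf{B}\,(\mathbf{B}\,a^\bullet)\,\mathbf{B}$.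 Write $a\circ b=\mathbf{B}\,a\,b$ (associative with unit $\mathbf{I}$ in such algebras). Let $\mathbf{B}^0=\mathbf{I}$, $\mathbf{B}^{k+1}=\mathbf{B}\circ\mathbf{B}^k$; note $\mathbf{B}^k\,f=\mathbf{B}(\mathbf{B}(\cdots(\mathbf{B}\,f)))$. A (planar) operad $\mathcal{P}$ is a family of sets $\mathcal{P}(n)$, $n\in\mathbf{N}$, with $\mathit{id}\in\mathcal{P}(1)$ and compositions $g(f_1,\dots,f_n)\in\mathcal{P}(k_1+\dots+k_n)$ for $g\in\mathcal{P}(n)$, $f_i\in\mathcal{P}(k_i)$, satisfying $f(\mathit{id},\dots,\mathit{id})=f=\mathit{id}(f)$ and the usual associativity law $h(g_1(f_{11},\dots,f_{1j_1}),\dots,g_k(f_{k1},\dots,f_{kj_k}))=(h(g_1,\dots,g_k))(f_{11},\dots,f_{kj_k})$. It is closed if it has $\mathbf{app}\in\mathcal{P}(2)$ such that for every $n$ and $p\in\mathcal{P}(n+1)$ there is a unique $\lambda(p)\in\mathcal{P}(n)$ with $\mathbf{app}(\lambda(p),\mathit{id})=p$. The internal operad $\mathcal{I}_{\mathcal{A}}$: $\mathcal{I}_{\mathcal{A}}(m)=\{a^\bullet\circ\mathbf{B}^m\mid a\in\mathcal{A}\}\subseteq\mathcal{A}$, $\mathit{id}=\mathbf{I}$, $\mathbf{app}=\mathbf{B}$, and for $g\in\mathcal{I}_{\mathcal{A}}(n)$, $f_i\in\mathcal{I}_{\mathcal{A}}(k_i)$, $g(f_1,\dots,f_n)=f_1\circ(\mathbf{B}\,f_2)\circ\cdots\circ(\mathbf{B}^{n-1}f_n)\circ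 g$. -}

module Defs where

open import Data.Nat using (ℕ; zero; suc)
open import Data.Fin using (Fin; zero; suc)
open import Data.Vec using (Vec; []; _∷_; _++_; lookup; replicate; tabulate; sum)
open import Data.Product using (Σ; _×_; _,_)
open import Function using (_∘′_)
open import Relation.Binary.PropositionalEquality using (_≡_)

record BIAlgebra : Set₁ where
  field
    Carrier : Set
    _·_     : Carrier → Carrier → Carrier
  infixl 9 _·_
  field
    𝐁 𝐈     : Carrier
    _•      : Carrier → Carrier
    I-ax    : ∀ a → 𝐈 · a ≡ a
    B-ax    : ∀ a b c → 𝐁 · a · b · c ≡ a · (b · c)
    •-ax    : ∀ a b → (a •) · b ≡ b · a
    BI≡I    : 𝐁 · 𝐈 ≡ 𝐈
    •-app   : ∀ a b → ((a · b) •) ≡ 𝐁 · (b •) · (𝐁 · (a •) · 𝐁)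
    ext-B   : 𝐁 · (𝐁 •) · (𝐁 · 𝐁 · (𝐁 · 𝐁 · 𝐁)) ≡ 𝐁 · (𝐁 · 𝐁) · 𝐁
    ext-I   : 𝐁 · (𝐈 •) · 𝐁 ≡ 𝐈
    ext-••  : ∀ a → 𝐁 · ((a •) •) · 𝐁 ≡ 𝐁 · (𝐁 · (a •)) · 𝐁

module Internal (𝒜 : BIAlgebra) where
  open BIAlgebra 𝒜

  infixr 7 _⊚_
  _⊚_ : Carrier → Carrier → Carrier
  a ⊚ b = 𝐁 · a · b

  Bpow : ℕ → Carrier
  Bpow zero    = 𝐈
  Bpow (suc k) = 𝐁 ⊚ Bpow k

  InI : ℕ → Carrier → Set
  InI m x = Σ Carrier (λ a → x ≡ (a •) ⊚ Bpow m)

  compFrom : ∀ {n} → ℕ → Vec Carrier n → Carrier → Carrier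
  compFrom k []       g = g
  compFrom k (f ∷ fs) g = (Bpow k · f) ⊚ compFrom (suc k) fs g

  -- operadic composition g(f1,...,fn) = f1 ∘ (B f2) ∘ ... ∘ (B^(n-1) fn) ∘ g
  comp : ∀ {n} → Carrier → Vec Carrier n → Carrier
  comp g fs = compFrom 0 fs g

  concatV : ∀ {k} (js : Vec ℕ k) → ((i : Fin k) → Vec Carrier (lookup js i)) → Vec Carrier (sum js)
  concatV []       fs = []
  concatV (j ∷ js) fs = fs zero ++ concatV js (λ i → fs (suc i))

  record IsClosedInternalOperad : Set where
    field
      id-mem   : InI 1 𝐈
      app-mem  : InI 2 𝐁
      comp-mem : ∀ {n} (g : Carrier) (ks : Vec ℕ n) (fs : Vec Carrier n) →
                 InI n g → (∀ i → InI (lookup ks i) (lookup fs i)) →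
                 InI (sum ks) (comp g fs)
      unit-r   : ∀ n f → InI n f → comp f (replicate n 𝐈) ≡ f
      unit-l   : ∀ n f → InI n f → comp 𝐈 (f ∷ []) ≡ f
      assoc    : ∀ {k} (h : Carrier) (js : Vec ℕ k) (gs : Vec Carrier k)
                 (ks : (i : Fin k) → Vec ℕ (lookup js i))
                 (fs : (i : Fin k) → Vec Carrier (lookup js i)) →
                 InI k h →
                 (∀ i → InI (lookup js i) (lookup gs i)) →
                 (∀ i j → InI (lookup (ks i) j) (lookup (fs i) j)) →
                 comp h (tabulate (λ i → comp (lookup gs i) (fs i)))
                   ≡ comp (comp h gs) (concatV js fs)
      closed   : ∀ n p → InI (suc n) p →
                 Σ Carrier (λ l → (InI n l × comp 𝐁 (l ∷ 𝐈 ∷ []) ≡ p) ×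
                   (∀ l′ → InI n l′ → comp 𝐁 (l′ ∷ 𝐈 ∷ []) ≡ p → l′ ≡ l))

{-# OPTIONS --safe #-}
-- Everything rests on the monoid (Carrier, 𝐁 · _ · _, 𝐈), the commutation
-- x ∘ a• = a• ∘ 𝐁x and the law (a b)• = b• ∘ a• ∘ 𝐁.  By induction on j, every
-- f ∈ I(j) satisfies 𝐁f ∘ 𝐁 = f• ∘ 𝐁^(j+1), and this is exactly what absorbs f,
-- placed in argument slot k, into an element e• ∘ 𝐁^(k+1+r): the result is
-- (𝐁^k f · e)• ∘ 𝐁^(k+j+r).  Composition g(f₁,…,fₙ) is the product
-- (f₁ ∘ 𝐁f₂ ∘ 𝐁²f₃ ∘ ⋯) ∘ g, and an m-ary g satisfies g ∘ 𝐁x = 𝐁^m x ∘ g, so the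
-- operad laws reduce to monoid identities.  Finally a• ∘ 𝐁^m applied to 𝐈 gives
-- back a, which yields the uniqueness of λ.
module Submission where

open import Defs
open import Data.Vec using (Vec; []; _∷_)
open import Data.Product using (Σ; _×_; _,_)
open import Function.Bundles using (_⇔_)
open import Function.Definitions using (Injective)
open import Relation.Binary.PropositionalEquality using (_≡_)

open import Algebra.Bundles using (Semigroup)
import Algebra.Properties.Semigroup as SemigroupProperties
open import Data.Fin using (Fin; zero; suc)
open import Data.Nat using (ℕ; zero; suc; _+_)
open import Data.Nat.Properties using (+-suc; +-assoc)
open import Data.Vec using (_++_; lookup; replicate; tabulate; sum)
open import Function.Bundles using (mk⇔)
open import Level using (0ℓ)
open import Relation.Binary.PropositionalEquality
  using (refl; sym; trans; cong; cong₂; subst; module ≡-Reasoning)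
open import Relation.Binary.PropositionalEquality.Algebra using (isMagma)

module Properties (𝒜 : BIAlgebra) where
  open BIAlgebra 𝒜
  open Internal 𝒜
  open ≡-Reasoning

  ⊚-identityˡ : ∀ x → 𝐈 ⊚ x ≡ x
  ⊚-identityˡ x = trans (cong (_· x) BI≡I) (I-ax x)

  ⊚-identityʳ : ∀ x → x ⊚ 𝐈 ≡ x
  ⊚-identityʳ x = begin
    𝐁 · x · 𝐈        ≡⟨ •-ax 𝐈 (𝐁 · x) ⟨
    𝐈 • · (𝐁 · x)    ≡⟨ B-ax (𝐈 •) 𝐁 x ⟨
    (𝐈 • ⊚ 𝐁) · x    ≡⟨ cong (_· x) ext-I ⟩
    𝐈 · x            ≡⟨ I-ax x ⟩
    x                ∎

  -- The extensionality axiom for 𝐁 in usable form; it makes 𝐁 · _ a homomorphism for ⊚.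
  𝐁⊚𝐁·-comm : ∀ y → 𝐁 ⊚ 𝐁 · y ≡ 𝐁 · (𝐁 · y) ⊚ 𝐁
  𝐁⊚𝐁·-comm y = begin
    𝐁 · 𝐁 · (𝐁 · y)                        ≡⟨ B-ax (𝐁 · 𝐁) 𝐁 y ⟨
    𝐁 · (𝐁 · 𝐁) · 𝐁 · y                    ≡⟨ cong (_· y) ext-B ⟨
    𝐁 · 𝐁 • · (𝐁 ⊚ 𝐁 ⊚ 𝐁) · y              ≡⟨ B-ax (𝐁 •) _ y ⟩
    𝐁 • · ((𝐁 ⊚ 𝐁 ⊚ 𝐁) · y)                ≡⟨ •-ax 𝐁 _ ⟩
    (𝐁 ⊚ 𝐁 ⊚ 𝐁) · y · 𝐁                    ≡⟨ cong (_· 𝐁) (B-ax 𝐁 (𝐁 ⊚ 𝐁) y) ⟩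
    𝐁 · ((𝐁 ⊚ 𝐁) · y) · 𝐁                  ≡⟨ cong (λ z → 𝐁 · z · 𝐁) (B-ax 𝐁 𝐁 y) ⟩
    𝐁 · (𝐁 · (𝐁 · y)) · 𝐁                  ∎

  𝐁·-⊚ : ∀ x y → 𝐁 · (x ⊚ y) ≡ 𝐁 · x ⊚ 𝐁 · y
  𝐁·-⊚ x y = begin
    𝐁 · (𝐁 · x · y)             ≡⟨ B-ax 𝐁 (𝐁 · x) y ⟨
    (𝐁 ⊚ 𝐁 · x) · y             ≡⟨ cong (_· y) (𝐁⊚𝐁·-comm x) ⟩
    (𝐁 · (𝐁 · x) ⊚ 𝐁) · y       ≡⟨ B-ax _ 𝐁 y ⟩
    𝐁 · x ⊚ 𝐁 · y               ∎

  ⊚-assoc : ∀ x y z → (x ⊚ y) ⊚ z ≡ x ⊚ y ⊚ z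
  ⊚-assoc x y z = trans (cong (_· z) (𝐁·-⊚ x y)) (B-ax (𝐁 · x) (𝐁 · y) z)

  ⊚-semigroup : Semigroup 0ℓ 0ℓ
  ⊚-semigroup = record { isSemigroup = record { isMagma = isMagma _⊚_ ; assoc = ⊚-assoc } }

  open SemigroupProperties ⊚-semigroup using (uv≈wx⇒u∙vy≈w∙xy)

  ⊚-•-comm : ∀ x a y → x ⊚ a • ⊚ y ≡ a • ⊚ 𝐁 · x ⊚ y
  ⊚-•-comm x a = uv≈wx⇒u∙vy≈w∙xy (begin
    𝐁 · x · a •                   ≡⟨ •-ax (a •) (𝐁 · x) ⟨
    (a •) • · (𝐁 · x)             ≡⟨ B-ax ((a •) •) 𝐁 x ⟨
    ((a •) • ⊚ 𝐁) · x             ≡⟨ cong (_· x) (ext-•• a) ⟩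
    (𝐁 · a • ⊚ 𝐁) · x             ≡⟨ B-ax _ 𝐁 x ⟩
    a • ⊚ 𝐁 · x                   ∎)

  •-app-⊚ : ∀ a b y → (a · b) • ⊚ y ≡ b • ⊚ a • ⊚ 𝐁 ⊚ y
  •-app-⊚ a b y = begin
    (a · b) • ⊚ y                ≡⟨ cong (_⊚ y) (•-app a b) ⟩
    (b • ⊚ a • ⊚ 𝐁) ⊚ y          ≡⟨ ⊚-assoc _ _ y ⟩
    b • ⊚ (a • ⊚ 𝐁) ⊚ y          ≡⟨ cong (b • ⊚_) (⊚-assoc _ _ y) ⟩
    b • ⊚ a • ⊚ 𝐁 ⊚ y            ∎

  ext-B-⊚ : ∀ y → 𝐁 • ⊚ 𝐁 ⊚ 𝐁 ⊚ 𝐁 ⊚ y ≡ 𝐁 · 𝐁 ⊚ 𝐁 ⊚ y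
  ext-B-⊚ y = begin
    𝐁 • ⊚ 𝐁 ⊚ 𝐁 ⊚ 𝐁 ⊚ y          ≡⟨ cong (λ z → 𝐁 • ⊚ 𝐁 ⊚ z) (⊚-assoc 𝐁 𝐁 y) ⟨
    𝐁 • ⊚ 𝐁 ⊚ (𝐁 ⊚ 𝐁) ⊚ y        ≡⟨ cong (𝐁 • ⊚_) (⊚-assoc 𝐁 (𝐁 ⊚ 𝐁) y) ⟨
    𝐁 • ⊚ (𝐁 ⊚ 𝐁 ⊚ 𝐁) ⊚ y        ≡⟨ uv≈wx⇒u∙vy≈w∙xy ext-B y ⟩
    𝐁 · 𝐁 ⊚ 𝐁 ⊚ y                ∎

  •-𝐁·-⊚ : ∀ x y → (𝐁 · x) • ⊚ 𝐁 ⊚ 𝐁 ⊚ y ≡ 𝐁 ⊚ x • ⊚ 𝐁 ⊚ y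
  •-𝐁·-⊚ x y = begin
    (𝐁 · x) • ⊚ 𝐁 ⊚ 𝐁 ⊚ y          ≡⟨ •-app-⊚ 𝐁 x _ ⟩
    x • ⊚ 𝐁 • ⊚ 𝐁 ⊚ 𝐁 ⊚ 𝐁 ⊚ y      ≡⟨ cong (x • ⊚_) (ext-B-⊚ y) ⟩
    x • ⊚ 𝐁 · 𝐁 ⊚ 𝐁 ⊚ y            ≡⟨ ⊚-•-comm 𝐁 x _ ⟨
    𝐁 ⊚ x • ⊚ 𝐁 ⊚ y                ∎

  infix 10 𝐁^[_]_
  𝐁^[_]_ : ℕ → Carrier → Carrier
  𝐁^[ zero ] x  = x
  𝐁^[ suc k ] x = 𝐁 · 𝐁^[ k ] x

  Bpow-· : ∀ k x → Bpow k · x ≡ 𝐁^[ k ] x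
  Bpow-· zero x    = I-ax x
  Bpow-· (suc k) x = trans (B-ax 𝐁 (Bpow k) x) (cong (𝐁 ·_) (Bpow-· k x))

  𝐁^[]-𝐈 : ∀ k → 𝐁^[ k ] 𝐈 ≡ 𝐈
  𝐁^[]-𝐈 zero    = refl
  𝐁^[]-𝐈 (suc k) = trans (cong (𝐁 ·_) (𝐁^[]-𝐈 k)) BI≡I

  𝐁^[]-⊚ : ∀ k x y → 𝐁^[ k ] (x ⊚ y) ≡ 𝐁^[ k ] x ⊚ 𝐁^[ k ] y
  𝐁^[]-⊚ zero x y    = refl
  𝐁^[]-⊚ (suc k) x y = trans (cong (𝐁 ·_) (𝐁^[]-⊚ k x y)) (𝐁·-⊚ _ _)

  𝐁^[]-𝐁· : ∀ k y → 𝐁^[ k ] (𝐁 · y) ≡ 𝐁 · 𝐁^[ k ] y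
  𝐁^[]-𝐁· zero y    = refl
  𝐁^[]-𝐁· (suc k) y = cong (𝐁 ·_) (𝐁^[]-𝐁· k y)

  Bpow-snoc : ∀ k → Bpow (suc k) ≡ Bpow k ⊚ 𝐁
  Bpow-snoc zero    = trans (⊚-identityʳ 𝐁) (sym (⊚-identityˡ 𝐁))
  Bpow-snoc (suc k) = trans (cong (𝐁 ⊚_) (Bpow-snoc k)) (sym (⊚-assoc 𝐁 (Bpow k) 𝐁))

  Bpow-+ : ∀ m n → Bpow (m + n) ≡ Bpow m ⊚ Bpow n
  Bpow-+ zero n    = sym (⊚-identityˡ _)
  Bpow-+ (suc m) n = trans (cong (𝐁 ⊚_) (Bpow-+ m n)) (sym (⊚-assoc 𝐁 (Bpow m) (Bpow n)))

  Bpow⊚𝐁·-comm : ∀ m y → Bpow m ⊚ 𝐁 · y ≡ 𝐁 · 𝐁^[ m ] y ⊚ Bpow m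
  Bpow⊚𝐁·-comm zero y    = trans (⊚-identityˡ _) (sym (⊚-identityʳ _))
  Bpow⊚𝐁·-comm (suc m) y = begin
    (𝐁 ⊚ Bpow m) ⊚ 𝐁 · y                   ≡⟨ ⊚-assoc _ _ _ ⟩
    𝐁 ⊚ Bpow m ⊚ 𝐁 · y                     ≡⟨ cong (𝐁 ⊚_) (Bpow⊚𝐁·-comm m y) ⟩
    𝐁 ⊚ 𝐁 · 𝐁^[ m ] y ⊚ Bpow m             ≡⟨ uv≈wx⇒u∙vy≈w∙xy (𝐁⊚𝐁·-comm _) _ ⟩
    𝐁 · 𝐁^[ suc m ] y ⊚ 𝐁 ⊚ Bpow m         ∎

  Bpow-InI : ∀ m → InI (suc m) (Bpow m)
  Bpow-InI m = 𝐈 , sym (begin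
    𝐈 • ⊚ 𝐁 ⊚ Bpow m        ≡⟨ ⊚-assoc _ _ _ ⟨
    (𝐈 • ⊚ 𝐁) ⊚ Bpow m      ≡⟨ cong (_⊚ Bpow m) ext-I ⟩
    𝐈 ⊚ Bpow m              ≡⟨ ⊚-identityˡ _ ⟩
    Bpow m                  ∎)

  InI⊚𝐁·-comm : ∀ m g → InI m g → ∀ y → g ⊚ 𝐁 · y ≡ 𝐁^[ m ] y ⊚ g
  InI⊚𝐁·-comm m _ (c , refl) y = begin
    (c • ⊚ Bpow m) ⊚ 𝐁 · y            ≡⟨ ⊚-assoc _ _ _ ⟩
    c • ⊚ Bpow m ⊚ 𝐁 · y              ≡⟨ cong (c • ⊚_) (Bpow⊚𝐁·-comm m y) ⟩
    c • ⊚ 𝐁 · 𝐁^[ m ] y ⊚ Bpow m      ≡⟨ ⊚-•-comm _ c _ ⟨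
    𝐁^[ m ] y ⊚ c • ⊚ Bpow m          ∎

  •⊚Bpow-⊚𝐁 : ∀ a m → (a • ⊚ Bpow m) ⊚ 𝐁 ≡ a • ⊚ Bpow (suc m)
  •⊚Bpow-⊚𝐁 a m = trans (⊚-assoc _ _ _) (cong (a • ⊚_) (sym (Bpow-snoc m)))

  Arity : ℕ → Carrier → Set
  Arity m f = 𝐁 · f ⊚ 𝐁 ≡ f • ⊚ Bpow (suc m)

  Arity-• : ∀ a → Arity 0 (a •)
  Arity-• a = trans (sym (ext-•• a)) (cong ((a •) • ⊚_) (sym (⊚-identityʳ 𝐁)))

  Arity-⊚𝐁 : ∀ m f → Arity m f → Arity (suc m) (f ⊚ 𝐁)
  Arity-⊚𝐁 m f arity = sym (begin
    (f ⊚ 𝐁) • ⊚ 𝐁 ⊚ 𝐁 ⊚ Bpow m                 ≡⟨ •-app-⊚ (𝐁 · f) 𝐁 _ ⟩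
    𝐁 • ⊚ (𝐁 · f) • ⊚ 𝐁 ⊚ 𝐁 ⊚ 𝐁 ⊚ Bpow m       ≡⟨ cong (𝐁 • ⊚_) (•-𝐁·-⊚ f _) ⟩
    𝐁 • ⊚ 𝐁 ⊚ f • ⊚ Bpow (suc (suc m))         ≡⟨ cong (λ z → 𝐁 • ⊚ 𝐁 ⊚ f • ⊚ z) (Bpow-snoc (suc m)) ⟩
    𝐁 • ⊚ 𝐁 ⊚ f • ⊚ Bpow (suc m) ⊚ 𝐁           ≡⟨ cong (λ z → 𝐁 • ⊚ 𝐁 ⊚ z) (uv≈wx⇒u∙vy≈w∙xy arity 𝐁) ⟨
    𝐁 • ⊚ 𝐁 ⊚ 𝐁 · f ⊚ 𝐁 ⊚ 𝐁                    ≡⟨ cong (𝐁 • ⊚_) (uv≈wx⇒u∙vy≈w∙xy (𝐁⊚𝐁·-comm f) _) ⟩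
    𝐁 • ⊚ 𝐁 · (𝐁 · f) ⊚ 𝐁 ⊚ 𝐁 ⊚ 𝐁              ≡⟨ ⊚-•-comm (𝐁 · f) 𝐁 _ ⟨
    𝐁 · f ⊚ 𝐁 • ⊚ 𝐁 ⊚ 𝐁 ⊚ 𝐁                    ≡⟨ cong (𝐁 · f ⊚_) ext-B ⟩
    𝐁 · f ⊚ 𝐁 · 𝐁 ⊚ 𝐁                          ≡⟨ ⊚-assoc _ _ _ ⟨
    (𝐁 · f ⊚ 𝐁 · 𝐁) ⊚ 𝐁                        ≡⟨ cong (_⊚ 𝐁) (𝐁·-⊚ f 𝐁) ⟨
    𝐁 · (f ⊚ 𝐁) ⊚ 𝐁                            ∎)

  InI⇒Arity : ∀ m f → InI m f → Arity m f
  InI⇒Arity zero _ (a , refl) = subst (Arity 0) (sym (⊚-identityʳ (a •))) (Arity-• a)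
  InI⇒Arity (suc m) _ (a , refl) =
    subst (Arity (suc m)) (•⊚Bpow-⊚𝐁 a m) (Arity-⊚𝐁 m _ (InI⇒Arity m _ (a , refl)))

  Arity-𝐁^[] : ∀ j f → Arity j f → ∀ k →
               𝐁 · 𝐁^[ k ] f ⊚ Bpow (suc k) ≡ (𝐁^[ k ] f) • ⊚ Bpow (suc (k + j))
  Arity-𝐁^[] j f arity zero = trans (cong (𝐁 · f ⊚_) (⊚-identityʳ 𝐁)) arity
  Arity-𝐁^[] j f arity (suc k) = begin
    𝐁 · (𝐁 · y) ⊚ 𝐁 ⊚ Bpow (suc k)       ≡⟨ uv≈wx⇒u∙vy≈w∙xy (𝐁⊚𝐁·-comm y) _ ⟨
    𝐁 ⊚ 𝐁 · y ⊚ Bpow (suc k)             ≡⟨ cong (𝐁 ⊚_) (Arity-𝐁^[] j f arity k) ⟩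
    𝐁 ⊚ y • ⊚ 𝐁 ⊚ Bpow (k + j)           ≡⟨ •-𝐁·-⊚ y _ ⟨
    (𝐁 · y) • ⊚ 𝐁 ⊚ 𝐁 ⊚ Bpow (k + j)     ∎
    where y = 𝐁^[ k ] f

  Arity⇒slot-absorb : ∀ j f → Arity j f → ∀ k e r →
                      𝐁^[ k ] f ⊚ e • ⊚ Bpow (suc k + r) ≡ (𝐁^[ k ] f · e) • ⊚ Bpow (k + j + r)
  Arity⇒slot-absorb j f arity k e r = begin
    y ⊚ e • ⊚ Bpow (suc k + r)                 ≡⟨ ⊚-•-comm y e _ ⟩
    e • ⊚ 𝐁 · y ⊚ Bpow (suc k + r)             ≡⟨ cong (λ z → e • ⊚ 𝐁 · y ⊚ z) (Bpow-+ (suc k) r) ⟩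
    e • ⊚ 𝐁 · y ⊚ Bpow (suc k) ⊚ Bpow r        ≡⟨ cong (e • ⊚_) (uv≈wx⇒u∙vy≈w∙xy (Arity-𝐁^[] j f arity k) _) ⟩
    e • ⊚ y • ⊚ Bpow (suc (k + j)) ⊚ Bpow r    ≡⟨ cong (λ z → e • ⊚ y • ⊚ z) (Bpow-+ (suc (k + j)) r) ⟨
    e • ⊚ y • ⊚ 𝐁 ⊚ Bpow (k + j + r)           ≡⟨ •-app-⊚ y e _ ⟨
    (y · e) • ⊚ Bpow (k + j + r)               ∎
    where y = 𝐁^[ k ] f

  compFrom-InI : ∀ {n} k (ks : Vec ℕ n) (fs : Vec Carrier n) g → InI (k + n) g →
                 (∀ i → InI (lookup ks i) (lookup fs i)) → InI (k + sum ks) (compFrom k fs g)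
  compFrom-InI k [] [] g g∈ _ = g∈
  compFrom-InI {suc n} k (j ∷ ks) (f ∷ fs) g g∈ fs∈
    with compFrom-InI (suc k) ks fs g (subst (λ m → InI m g) (+-suc k n) g∈) (λ i → fs∈ (suc i))
  ... | e , rest≡ = 𝐁^[ k ] f · e , (begin
    Bpow k · f ⊚ compFrom (suc k) fs g             ≡⟨ cong₂ _⊚_ (Bpow-· k f) rest≡ ⟩
    𝐁^[ k ] f ⊚ e • ⊚ Bpow (suc k + sum ks)
      ≡⟨ Arity⇒slot-absorb j f (InI⇒Arity j f (fs∈ zero)) k e (sum ks) ⟩
    (𝐁^[ k ] f · e) • ⊚ Bpow (k + j + sum ks)
      ≡⟨ cong (λ m → (𝐁^[ k ] f · e) • ⊚ Bpow m) (+-assoc k j (sum ks)) ⟩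
    (𝐁^[ k ] f · e) • ⊚ Bpow (k + (j + sum ks))    ∎)

  spread : ∀ {n} → Vec Carrier n → Carrier
  spread []       = 𝐈
  spread (f ∷ fs) = f ⊚ 𝐁 · spread fs

  compFrom-spread : ∀ {n} k (fs : Vec Carrier n) g → compFrom k fs g ≡ 𝐁^[ k ] spread fs ⊚ g
  compFrom-spread k [] g = sym (trans (cong (_⊚ g) (𝐁^[]-𝐈 k)) (⊚-identityˡ g))
  compFrom-spread k (f ∷ fs) g = begin
    Bpow k · f ⊚ compFrom (suc k) fs g                  ≡⟨ cong₂ _⊚_ (Bpow-· k f) (compFrom-spread (suc k) fs g) ⟩
    𝐁^[ k ] f ⊚ 𝐁 · 𝐁^[ k ] spread fs ⊚ g              ≡⟨ cong (λ z → 𝐁^[ k ] f ⊚ z ⊚ g) (𝐁^[]-𝐁· k (spread fs)) ⟨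
    𝐁^[ k ] f ⊚ 𝐁^[ k ] (𝐁 · spread fs) ⊚ g            ≡⟨ ⊚-assoc _ _ _ ⟨
    (𝐁^[ k ] f ⊚ 𝐁^[ k ] (𝐁 · spread fs)) ⊚ g          ≡⟨ cong (_⊚ g) (𝐁^[]-⊚ k f (𝐁 · spread fs)) ⟨
    𝐁^[ k ] spread (f ∷ fs) ⊚ g                         ∎

  comp-spread : ∀ {n} g (fs : Vec Carrier n) → comp g fs ≡ spread fs ⊚ g
  comp-spread g fs = compFrom-spread 0 fs g

  spread-++ : ∀ {m n} (v : Vec Carrier m) (w : Vec Carrier n) →
              spread (v ++ w) ≡ spread v ⊚ 𝐁^[ m ] spread w
  spread-++ [] w = sym (⊚-identityˡ _)
  spread-++ {suc m} (f ∷ v) w = begin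
    f ⊚ 𝐁 · spread (v ++ w)                        ≡⟨ cong (λ z → f ⊚ 𝐁 · z) (spread-++ v w) ⟩
    f ⊚ 𝐁 · (spread v ⊚ 𝐁^[ m ] spread w)          ≡⟨ cong (f ⊚_) (𝐁·-⊚ _ _) ⟩
    f ⊚ 𝐁 · spread v ⊚ 𝐁 · 𝐁^[ m ] spread w        ≡⟨ ⊚-assoc _ _ _ ⟨
    spread (f ∷ v) ⊚ 𝐁^[ suc m ] spread w          ∎

  spread-tabulate-comp : ∀ {k} (js : Vec ℕ k) (gs : Vec Carrier k)
                         (fs : (i : Fin k) → Vec Carrier (lookup js i)) →
                         (∀ i → InI (lookup js i) (lookup gs i)) →
                         spread (tabulate (λ i → comp (lookup gs i) (fs i)))
                           ≡ spread (concatV js fs) ⊚ spread gs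
  spread-tabulate-comp [] [] fs gs∈ = sym (⊚-identityˡ 𝐈)
  spread-tabulate-comp (j ∷ js) (g ∷ gs) fs gs∈ = begin
    comp g (fs zero) ⊚ 𝐁 · spread (tabulate (λ i → comp (lookup gs i) (fs (suc i))))
      ≡⟨ cong₂ (λ x y → x ⊚ 𝐁 · y) (comp-spread g (fs zero))
               (spread-tabulate-comp js gs (λ i → fs (suc i)) (λ i → gs∈ (suc i))) ⟩
    (F ⊚ g) ⊚ 𝐁 · (C ⊚ G)              ≡⟨ cong ((F ⊚ g) ⊚_) (𝐁·-⊚ C G) ⟩
    (F ⊚ g) ⊚ 𝐁 · C ⊚ 𝐁 · G            ≡⟨ ⊚-assoc _ _ _ ⟩
    F ⊚ g ⊚ 𝐁 · C ⊚ 𝐁 · G              ≡⟨ cong (F ⊚_) (⊚-assoc _ _ _) ⟨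
    F ⊚ (g ⊚ 𝐁 · C) ⊚ 𝐁 · G            ≡⟨ cong (λ z → F ⊚ z ⊚ 𝐁 · G) (InI⊚𝐁·-comm j g (gs∈ zero) C) ⟩
    F ⊚ (𝐁^[ j ] C ⊚ g) ⊚ 𝐁 · G        ≡⟨ cong (F ⊚_) (⊚-assoc _ _ _) ⟩
    F ⊚ 𝐁^[ j ] C ⊚ g ⊚ 𝐁 · G          ≡⟨ ⊚-assoc _ _ _ ⟨
    (F ⊚ 𝐁^[ j ] C) ⊚ spread (g ∷ gs)  ≡⟨ cong (_⊚ spread (g ∷ gs)) (spread-++ (fs zero) rest) ⟨
    spread (concatV (j ∷ js) fs) ⊚ spread (g ∷ gs) ∎
    where
      F = spread (fs zero)
      rest = concatV js (λ i → fs (suc i))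
      C = spread rest
      G = spread gs

  compFrom-replicate-𝐈 : ∀ k n f → compFrom k (replicate n 𝐈) f ≡ f
  compFrom-replicate-𝐈 k zero f    = refl
  compFrom-replicate-𝐈 k (suc n) f =
    trans (cong₂ _⊚_ (trans (Bpow-· k 𝐈) (𝐁^[]-𝐈 k)) (compFrom-replicate-𝐈 (suc k) n f)) (⊚-identityˡ f)

  comp-assoc : ∀ {k} (h : Carrier) (js : Vec ℕ k) (gs : Vec Carrier k)
               (fs : (i : Fin k) → Vec Carrier (lookup js i)) →
               (∀ i → InI (lookup js i) (lookup gs i)) →
               comp h (tabulate (λ i → comp (lookup gs i) (fs i))) ≡ comp (comp h gs) (concatV js fs)
  comp-assoc h js gs fs gs∈ = begin
    comp h composites                          ≡⟨ comp-spread h composites ⟩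
    spread composites ⊚ h                      ≡⟨ cong (_⊚ h) (spread-tabulate-comp js gs fs gs∈) ⟩
    (spread (concatV js fs) ⊚ spread gs) ⊚ h   ≡⟨ ⊚-assoc _ _ _ ⟩
    spread (concatV js fs) ⊚ spread gs ⊚ h     ≡⟨ cong (spread (concatV js fs) ⊚_) (comp-spread h gs) ⟨
    spread (concatV js fs) ⊚ comp h gs         ≡⟨ comp-spread (comp h gs) (concatV js fs) ⟨
    comp (comp h gs) (concatV js fs)           ∎
    where composites = tabulate (λ i → comp (lookup gs i) (fs i))

  comp-binary : ∀ g x y → comp g (x ∷ y ∷ []) ≡ x ⊚ 𝐁 · y ⊚ g
  comp-binary g x y = cong₂ _⊚_ (Bpow-· 0 x) (cong (_⊚ g) (Bpow-· 1 y))

  comp-𝐁-𝐈 : ∀ l → comp 𝐁 (l ∷ 𝐈 ∷ []) ≡ l ⊚ 𝐁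
  comp-𝐁-𝐈 l = trans (comp-binary 𝐁 l 𝐈) (cong (l ⊚_) (trans (cong (_⊚ 𝐁) BI≡I) (⊚-identityˡ 𝐁)))

  •·𝐈 : ∀ c → c • · 𝐈 ≡ c
  •·𝐈 c = trans (•-ax c 𝐈) (I-ax c)

  •⊚Bpow-·𝐈 : ∀ m c → (c • ⊚ Bpow m) · 𝐈 ≡ c
  •⊚Bpow-·𝐈 m c = begin
    (c • ⊚ Bpow m) · 𝐈    ≡⟨ B-ax (c •) (Bpow m) 𝐈 ⟩
    c • · (Bpow m · 𝐈)    ≡⟨ cong (c • ·_) (trans (Bpow-· m 𝐈) (𝐁^[]-𝐈 m)) ⟩
    c • · 𝐈               ≡⟨ •·𝐈 c ⟩
    c                     ∎

  •⊚Bpow-injective : ∀ m {c d} → c • ⊚ Bpow m ≡ d • ⊚ Bpow m → c ≡ d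
  •⊚Bpow-injective m {c} {d} eq =
    trans (sym (•⊚Bpow-·𝐈 m c)) (trans (cong (_· 𝐈) eq) (•⊚Bpow-·𝐈 m d))

  app-•⊚Bpow : ∀ a n → comp 𝐁 (a • ⊚ Bpow n ∷ 𝐈 ∷ []) ≡ a • ⊚ Bpow (suc n)
  app-•⊚Bpow a n = trans (comp-𝐁-𝐈 _) (•⊚Bpow-⊚𝐁 a n)

  InI-closed : ∀ n p → InI (suc n) p →
               Σ Carrier (λ l → (InI n l × comp 𝐁 (l ∷ 𝐈 ∷ []) ≡ p) ×
                 (∀ l′ → InI n l′ → comp 𝐁 (l′ ∷ 𝐈 ∷ []) ≡ p → l′ ≡ l))
  InI-closed n _ (a , refl) = a • ⊚ Bpow n , ((a , refl) , app-•⊚Bpow a n) , unique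
    where
      unique : ∀ l′ → InI n l′ → comp 𝐁 (l′ ∷ 𝐈 ∷ []) ≡ a • ⊚ Bpow (suc n) → l′ ≡ a • ⊚ Bpow n
      unique _ (c , refl) eq =
        cong (λ z → z • ⊚ Bpow n) (•⊚Bpow-injective (suc n) (trans (sym (app-•⊚Bpow c n)) eq))

  isClosedInternalOperad : IsClosedInternalOperad
  isClosedInternalOperad = record
    { id-mem   = Bpow-InI 0
    ; app-mem  = subst (InI 2) (⊚-identityʳ 𝐁) (Bpow-InI 1)
    ; comp-mem = λ g ks fs g∈ fs∈ → compFrom-InI 0 ks fs g g∈ fs∈
    ; unit-r   = λ n f _ → compFrom-replicate-𝐈 0 n f
    ; unit-l   = λ n f _ → trans (⊚-identityʳ _) (I-ax f)
    ; assoc    = λ h js gs _ fs _ gs∈ _ → comp-assoc h js gs fs gs∈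
    ; closed   = InI-closed
    }

  InI-zero⇔ : ∀ x → InI 0 x ⇔ Σ Carrier (λ a → x ≡ a •)
  InI-zero⇔ x = mk⇔ (λ { (a , eq) → a , trans eq (⊚-identityʳ _) })
                    (λ { (a , eq) → a , trans eq (sym (⊚-identityʳ _)) })

  •-injective : Injective _≡_ _≡_ _•
  •-injective {c} {d} eq = trans (sym (•·𝐈 c)) (trans (cong (_· 𝐈) eq) (•·𝐈 d))

  •-app-comp : ∀ a b → (a · b) • ≡ comp 𝐁 (a • ∷ b • ∷ [])
  •-app-comp a b = begin
    (a · b) •                ≡⟨ •-app a b ⟩
    b • ⊚ a • ⊚ 𝐁            ≡⟨ ⊚-•-comm (b •) a 𝐁 ⟩
    a • ⊚ 𝐁 · b • ⊚ 𝐁        ≡⟨ comp-binary 𝐁 (a •) (b •) ⟨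
    comp 𝐁 (a • ∷ b • ∷ [])  ∎

proposition4p1 : (𝒜 : BIAlgebra) →
    let open BIAlgebra 𝒜 in
    let open Internal 𝒜 in
    IsClosedInternalOperad
    × (∀ x → InI 0 x ⇔ Σ Carrier (λ a → x ≡ (a •)))
    × Injective _≡_ _≡_ _•
    × (∀ a b → ((a · b) •) ≡ comp 𝐁 ((a •) ∷ (b •) ∷ []))
proposition4p1 𝒜 = isClosedInternalOperad , InI-zero⇔ , •-injective , •-app-comp
  where open Properties 𝒜
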